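{- In CCS with signals (CCSS), strong bisimilarity $\sim$ is a congruence for all operators. That is, for all CCSS expressions: if $P\sim Q$ then $\alpha.P\sim\alpha.Q$ for every $\alpha\in Act$, $P|R\sim Q|R$ and $R|P\sim R|Q$ for every $R$, $P\backslash L\sim Q\backslash L$ for every $L\subseteq\mathcal A\cup\mathcal S$, $P[f]\sim Q[f]$ for every relabelling $f$, and $P\,\hat{}\,s\sim Q\,\hat{}\,s$ for every signal $s$; and if $P_i\sim Q_i$ for all $i\in I$ then $\sum_{i\in I}P_i\sim\sum_{i\in I}Q_i$.
   Context: CCSS is parametrised by a set $\mathcal A$ of names, a set $\mathcal K$ of agent identifiers and a set $\mathcal S$ of signals. Handshake actions: $\mathcal H=\mathcal A\cup\bar{\mathcal A}$ with $\bar{\mathcal A}=\{\bar a\mid a\in\mathcal A\}$ and $\bar{\bar a}=a$. Actions: $Act=\mathcal S\cup\mathcal H\cup\{\tau\}$ (disjoint union). A relabelling is a function $f$ mapping $\mathcal S\to\mathcal S$ and $\mathcal H\to\mathcal H$ with $f(\bar a)=\overline{f(a)}$, extended by $f(\tau)=\tau$. CCSS expressions are generated by: agent identifiers $A\in\mathcal K$; prefixes $\alpha.P$ ($\alpha\in Act$); choices $\sum_{i\in I}P_i$ ($I$ any index set); parallel compositions $P|Q$; restrictions $P\backslash L$ with $L\subseteq\mathcal A\cup\mathcal S$; relabellings $P[f]$; signallings $P\,\hat{}\,s$ with $s\in\mathcal S$. Each $A\in\mathcal K$ has a defining equation $A\stackrel{def}{=}P$. The semantics consists of a transition relation $P\xrightarrow{\alpha}P'$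 ($\alpha\in Act$) and an emission predicate $P\curvearrowright s$ ($s\in\mathcal S$), the least ones closed under the rules: $\alpha.P\xrightarrow{\alpha}P$; if $P_j\xrightarrow{\alpha}P'$ with $j\in I$ then $\sum_{i\in I}P_i\xrightarrow{\alpha}P'$; if $P\xrightarrow{\alpha}P'$ then $P|Q\xrightarrow{\alpha}P'|Q$; if $Q\xrightarrow{\alpha}Q'$ then $P|Q\xrightarrow{\alpha}P|Q'$; if $P\xrightarrow{a}P'$ and $Q\xrightarrow{\bar a}Q'$ with $a\in\mathcal H$ then $P|Q\xrightarrow{\tau}P'|Q'$; if $P\xrightarrow{\alpha}P'$ and neither $\alpha$ nor (for $\alpha\in\mathcal H$) $\bar\alpha$ lies in $L$ then $P\backslash L\xrightarrow{\alpha}P'\backslash L$; if $P\xrightarrow{\alpha}P'$ then $P[f]\xrightarrow{f(\alpha)}P'[f]$; if $P\xrightarrow{\alpha}P'$ and $A\stackrel{def}{=}P$ then $A\xrightarrow{\alpha}P'$; $(P\,\hat{}\,s)\curvearrowright s$; if $P\xrightarrow{\alpha}P'$ then $P\,\hat{}\,s\xrightarrow{\alpha}P'$; if $P\curvearrowright s$ then $(P\,\hat{}\,t)\curvearrowright s$; if $P_j\curvearrowright s$ with $j\in I$ then $(\sum_{i\in I}P_i)\curvearrowright s$; if $P\curvearrowright s$ then $(P|Q)\curvearrowright s$ and $(Q|P)\curvearrowright s$; if $P\curvearrowright s$ and $Q\xrightarrow{s}Q'$ then $P|Q\xrightarrow{\tau}P|Q'$; if $P\xrightarrow{s}P'$ and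 $Q\curvearrowright s$ then $P|Q\xrightarrow{\tau}P'|Q$; if $P\curvearrowright s$ and $s\notin L$ then $(P\backslash L)\curvearrowright s$; if $P\curvearrowright s$ then $P[f]\curvearrowright f(s)$; if $P\curvearrowright s$ and $A\stackrel{def}{=}P$ then $A\curvearrowright s$. A strong bisimulation is a symmetric relation $R$ on CCSS expressions such that whenever $P\,R\,Q$: if $P\xrightarrow{\alpha}P'$ then $Q\xrightarrow{\alpha}Q'$ for some $Q'$ with $P'\,R\,Q'$, and if $P\curvearrowright s$ then $Q\curvearrowright s$. Strong bisimilarity $\sim$ is the union of all strong bisimulations. -}

module Defs where

open import Data.Empty using (⊥)
open import Data.Sum using (_⊎_; inj₁; inj₂)
open import Data.Product using (Σ; _×_)
open import Relation.Nullary using (¬_)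
open import Relation.Binary.PropositionalEquality using (_≡_)

-- Parameters: N = names 𝒜, K = agent identifiers 𝒦, S = signals 𝒮.

data Hs (N : Set) : Set where
  nm : N → Hs N
  co : N → Hs N

bar : {N : Set} → Hs N → Hs N
bar (nm a) = co a
bar (co a) = nm a

name : {N : Set} → Hs N → N
name (nm a) = a
name (co a) = a

data Act (N S : Set) : Set where
  sig : S → Act N S
  hs  : Hs N → Act N S
  τ   : Act N S

record Relabelling (N S : Set) : Set where
  field
    fS   : S → S
    fH   : Hs N → Hs N
    fbar : ∀ h → fH (bar h) ≡ bar (fH h)

applyR : {N S : Set} → Relabelling N S → Act N S → Act N S
applyR f (sig s) = sig (Relabelling.fS f s)
applyR f (hs h)  = hs (Relabelling.fH f h)
applyR f τ       = τ

-- CCSS expressions. Choice over an arbitrary index set I : Set;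
-- restriction sets L ⊆ 𝒜 ∪ 𝒮 given as predicates on N ⊎ S.
data Proc (N K S : Set) : Set₁ where
  agent : K → Proc N K S
  _∙_   : Act N S → Proc N K S → Proc N K S
  Sum   : (I : Set) → (I → Proc N K S) → Proc N K S
  _∣_   : Proc N K S → Proc N K S → Proc N K S
  _∖_   : Proc N K S → (N ⊎ S → Set) → Proc N K S
  _[_]  : Proc N K S → Relabelling N S → Proc N K S
  _^_   : Proc N K S → S → Proc N K S

-- "α ∈ L or ᾱ ∈ L" (for α ∈ ℋ both reduce to: the underlying name is in L)
InL : {N S : Set} → (N ⊎ S → Set) → Act N S → Set
InL L (sig s) = L (inj₂ s)
InL L (hs h)  = L (inj₁ (name h))
InL L τ       = ⊥

-- Semantics, relative to the defining equations Δ : K → Proc (A ≝ Δ A).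
mutual
  data Step {N K S : Set} (Δ : K → Proc N K S)
       : Proc N K S → Act N S → Proc N K S → Set₁ where
    pre   : ∀ {α P} → Step Δ (α ∙ P) α P
    sum   : ∀ {I Ps α P'} (j : I) → Step Δ (Ps j) α P' → Step Δ (Sum I Ps) α P'
    parL  : ∀ {P Q α P'} → Step Δ P α P' → Step Δ (P ∣ Q) α (P' ∣ Q)
    parR  : ∀ {P Q α Q'} → Step Δ Q α Q' → Step Δ (P ∣ Q) α (P ∣ Q')
    comm  : ∀ {P Q P' Q'} (a : Hs N) → Step Δ P (hs a) P' → Step Δ Q (hs (bar a)) Q'
          → Step Δ (P ∣ Q) τ (P' ∣ Q')
    res   : ∀ {P L α P'} → Step Δ P α P' → ¬ InL L α → Step Δ (P ∖ L) α (P' ∖ L)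
    rel   : ∀ {P f α P'} → Step Δ P α P' → Step Δ (P [ f ]) (applyR f α) (P' [ f ])
    rec   : ∀ {A α P'} → Step Δ (Δ A) α P' → Step Δ (agent A) α P'
    sigt  : ∀ {P s α P'} → Step Δ P α P' → Step Δ (P ^ s) α P'
    sigL  : ∀ {P Q Q' s} → Emits Δ P s → Step Δ Q (sig s) Q' → Step Δ (P ∣ Q) τ (P ∣ Q')
    sigR  : ∀ {P Q P' s} → Step Δ P (sig s) P' → Emits Δ Q s → Step Δ (P ∣ Q) τ (P' ∣ Q)

  data Emits {N K S : Set} (Δ : K → Proc N K S) : Proc N K S → S → Set₁ where
    e-sig  : ∀ {P s} → Emits Δ (P ^ s) s
    e-sigt : ∀ {P s t} → Emits Δ P s → Emits Δ (P ^ t) s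
    e-sum  : ∀ {I Ps s} (j : I) → Emits Δ (Ps j) s → Emits Δ (Sum I Ps) s
    e-parL : ∀ {P Q s} → Emits Δ P s → Emits Δ (P ∣ Q) s
    e-parR : ∀ {P Q s} → Emits Δ P s → Emits Δ (Q ∣ P) s
    e-res  : ∀ {P L s} → Emits Δ P s → ¬ L (inj₂ s) → Emits Δ (P ∖ L) s
    e-rel  : ∀ {P f s} → Emits Δ P s → Emits Δ (P [ f ]) (Relabelling.fS f s)
    e-rec  : ∀ {A s} → Emits Δ (Δ A) s → Emits Δ (agent A) s

record IsStrongBisim {N K S : Set} (Δ : K → Proc N K S)
       (R : Proc N K S → Proc N K S → Set₁) : Set₂ where
  field
    symm  : ∀ {P Q} → R P Q → R Q P
    trans : ∀ {P Q α P'} → R P Q → Step Δ P α P'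
          → Σ (Proc N K S) (λ Q' → Step Δ Q α Q' × R P' Q')
    emit  : ∀ {P Q s} → R P Q → Emits Δ P s → Emits Δ Q s

Bisimilar : {N K S : Set} (Δ : K → Proc N K S) → Proc N K S → Proc N K S → Set₂
Bisimilar {N} {K} {S} Δ P Q =
  Σ (Proc N K S → Proc N K S → Set₁) (λ R → IsStrongBisim Δ R × R P Q)

module Submission where

-- Bisimilarity lives one universe above the relations it quantifies over,
-- so it cannot itself serve as the witness bisimulation; instead we exhibit,
-- for each claim, a concrete bisimulation containing the required pair.
--
--   * The congruence closure `Cong R` of a relation R relates two terms
--     built by the same operators from R-related (or identical) arguments.
--     If R is a strong bisimulation, so is `Cong R` (`congIsBisim`): the
--     transfer and emission conditions are checked operator by operator,
--     the signal-synchronisation rules using that emission is transferred.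
--   * A choice combines infinitely many bisimilar pairs, each witnessed by a
--     different bisimulation; their union (`unionIsBisim`) is again a strong
--     bisimulation and contains all of them.
--
-- The theorem follows: each operator applied to a bisimilar pair is related
-- by the congruence closure of its witness, and a choice of bisimilar
-- components by the congruence closure of the union of the witnesses.

open import Defs
open import Data.Sum using (_⊎_)
open import Data.Product using (_×_; Σ; _,_; proj₁; proj₂)

module _ {N K S : Set} (Δ : K → Proc N K S) where

  Rel : Set₂
  Rel = Proc N K S → Proc N K S → Set₁

  Bisimulation : Set₂
  Bisimulation = Σ Rel (IsStrongBisim Δ)

  bisimilar : (B : Bisimulation) {P Q : Proc N K S} → proj₁ B P Q → Bisimilar Δ P Q
  bisimilar (R , isB) r = R , isB , r

  Union : {I : Set} → (I → Bisimulation) → Rel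
  Union {I} B P Q = Σ I (λ i → proj₁ (B i) P Q)

  unionIsBisim : {I : Set} (B : I → Bisimulation) → IsStrongBisim Δ (Union B)
  unionIsBisim B = record
    { symm  = λ { (i , r) → i , symm (proj₂ (B i)) r }
    ; trans = λ { (i , r) st → let (Q' , st' , r') = trans (proj₂ (B i)) r st
                               in Q' , st' , (i , r') }
    ; emit  = λ { (i , r) e → emit (proj₂ (B i)) r e }
    }
    where open IsStrongBisim

  data Cong (R : Rel) : Rel where
    base   : ∀ {P Q} → R P Q → Cong R P Q
    refl   : ∀ {P} → Cong R P P
    prefix : ∀ {α P Q} → Cong R P Q → Cong R (α ∙ P) (α ∙ Q)
    par    : ∀ {P Q P' Q'} → Cong R P Q → Cong R P' Q' → Cong R (P ∣ P') (Q ∣ Q')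
    restr  : ∀ {P Q L} → Cong R P Q → Cong R (P ∖ L) (Q ∖ L)
    relab  : ∀ {P Q f} → Cong R P Q → Cong R (P [ f ]) (Q [ f ])
    signal : ∀ {P Q s} → Cong R P Q → Cong R (P ^ s) (Q ^ s)
    choice : ∀ {I Ps Qs} → ((i : I) → Cong R (Ps i) (Qs i))
           → Cong R (Sum I Ps) (Sum I Qs)

  module _ {R : Rel} (isB : IsStrongBisim Δ R) where
    open IsStrongBisim isB

    congSymm : ∀ {P Q} → Cong R P Q → Cong R Q P
    congSymm (base r)   = base (symm r)
    congSymm refl       = refl
    congSymm (prefix c) = prefix (congSymm c)
    congSymm (par c d)  = par (congSymm c) (congSymm d)
    congSymm (restr c)  = restr (congSymm c)
    congSymm (relab c)  = relab (congSymm c)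
    congSymm (signal c) = signal (congSymm c)
    congSymm (choice h) = choice (λ i → congSymm (h i))

    congEmit : ∀ {P Q s} → Cong R P Q → Emits Δ P s → Emits Δ Q s
    congEmit (base r)   e            = emit r e
    congEmit refl       e            = e
    congEmit (prefix c) ()
    congEmit (par c d)  (e-parL e)   = e-parL (congEmit c e)
    congEmit (par c d)  (e-parR e)   = e-parR (congEmit d e)
    congEmit (restr c)  (e-res e s∉L) = e-res (congEmit c e) s∉L
    congEmit (relab c)  (e-rel e)    = e-rel (congEmit c e)
    congEmit (signal c) e-sig        = e-sig
    congEmit (signal c) (e-sigt e)   = e-sigt (congEmit c e)
    congEmit (choice h) (e-sum j e)  = e-sum j (congEmit (h j) e)

    -- A prefix, signalling or choice
    -- is consumed by its step, so the residuals are related by a premise.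
    congStep : ∀ {P Q α P'} → Cong R P Q → Step Δ P α P'
             → Σ (Proc N K S) (λ Q' → Step Δ Q α Q' × Cong R P' Q')
    congStep (base r) st with trans r st
    ... | Q' , st' , r' = Q' , st' , base r'
    congStep refl st = _ , st , refl
    congStep (prefix c) pre = _ , pre , c
    congStep (par c d) (parL st) with congStep c st
    ... | _ , st' , c' = _ , parL st' , par c' d
    congStep (par c d) (parR st) with congStep d st
    ... | _ , st' , d' = _ , parR st' , par c d'
    congStep (par c d) (comm a st₁ st₂) with congStep c st₁ | congStep d st₂
    ... | _ , st₁' , c' | _ , st₂' , d' = _ , comm a st₁' st₂' , par c' d'
    congStep (par c d) (sigL e st) with congStep d st
    ... | _ , st' , d' = _ , sigL (congEmit c e) st' , par c d'
    congStep (par c d) (sigR st e) with congStep c st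
    ... | _ , st' , c' = _ , sigR st' (congEmit d e) , par c' d
    congStep (restr c) (res st α∉L) with congStep c st
    ... | _ , st' , c' = _ , res st' α∉L , restr c'
    congStep (relab c) (rel st) with congStep c st
    ... | _ , st' , c' = _ , rel st' , relab c'
    congStep (signal c) (sigt st) with congStep c st
    ... | _ , st' , c' = _ , sigt st' , c'
    congStep (choice h) (sum j st) with congStep (h j) st
    ... | _ , st' , c' = _ , sum j st' , c'

    congIsBisim : IsStrongBisim Δ (Cong R)
    congIsBisim = record { symm = congSymm ; trans = congStep ; emit = congEmit }

  congBisimilar : (B : Bisimulation) {P Q : Proc N K S}
                → Cong (proj₁ B) P Q → Bisimilar Δ P Q
  congBisimilar (R , isB) = bisimilar (Cong R , congIsBisim isB)

mainTheorem1 : (N K S : Set) (Δ : K → Proc N K S)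
    → ((P Q : Proc N K S) → Bisimilar Δ P Q →
          ((α : Act N S) → Bisimilar Δ (α ∙ P) (α ∙ Q))
        × ((R : Proc N K S) → Bisimilar Δ (P ∣ R) (Q ∣ R))
        × ((R : Proc N K S) → Bisimilar Δ (R ∣ P) (R ∣ Q))
        × ((L : N ⊎ S → Set) → Bisimilar Δ (P ∖ L) (Q ∖ L))
        × ((f : Relabelling N S) → Bisimilar Δ (P [ f ]) (Q [ f ]))
        × ((s : S) → Bisimilar Δ (P ^ s) (Q ^ s)))
    × ((I : Set) (Ps Qs : I → Proc N K S) → ((i : I) → Bisimilar Δ (Ps i) (Qs i))
        → Bisimilar Δ (Sum I Ps) (Sum I Qs))
mainTheorem1 N K S Δ = operators , choices
  where
  operators : (P Q : Proc N K S) → Bisimilar Δ P Q →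
          ((α : Act N S) → Bisimilar Δ (α ∙ P) (α ∙ Q))
        × ((R : Proc N K S) → Bisimilar Δ (P ∣ R) (Q ∣ R))
        × ((R : Proc N K S) → Bisimilar Δ (R ∣ P) (R ∣ Q))
        × ((L : N ⊎ S → Set) → Bisimilar Δ (P ∖ L) (Q ∖ L))
        × ((f : Relabelling N S) → Bisimilar Δ (P [ f ]) (Q [ f ]))
        × ((s : S) → Bisimilar Δ (P ^ s) (Q ^ s))
  operators P Q (R , isB , r) =
      (λ α → ∼ (prefix (base r)))
    , (λ _ → ∼ (par (base r) refl))
    , (λ _ → ∼ (par refl (base r)))
    , (λ _ → ∼ (restr (base r)))
    , (λ _ → ∼ (relab (base r)))
    , (λ _ → ∼ (signal (base r)))
    where
    ∼ : ∀ {P' Q'} → Cong Δ R P' Q' → Bisimilar Δ P' Q'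
    ∼ = congBisimilar Δ (R , isB)

  -- Each component pair is in its own witness, hence in the union.
  choices : (I : Set) (Ps Qs : I → Proc N K S) → ((i : I) → Bisimilar Δ (Ps i) (Qs i))
          → Bisimilar Δ (Sum I Ps) (Sum I Qs)
  choices I Ps Qs bisims =
    congBisimilar Δ (Union Δ witness , unionIsBisim Δ witness)
      (choice (λ i → base (i , proj₂ (proj₂ (bisims i)))))
    where
    witness : I → Bisimulation Δ
    witness i = proj₁ (bisims i) , proj₁ (proj₂ (bisims i))
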